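{- Let $k \geq 1$ and define $\mathrm{mem}: \{0,1\}^{2^k} \to \{0,1\}^k$ by $$\mathrm{mem}(\tau)_j = \bigoplus_{J=0}^{2^k-1} \mathrm{bin}(J)_j \cdot \tau_J \qquad (j = 0,\dots,k-1),$$ where $\tau = (\tau_0,\dots,\tau_{2^k-1})$ and $\mathrm{bin}(J) \in \{0,1\}^k$ is the binary representation of $J$ (so $\mathrm{bin}(J)_j$ is the coefficient of $2^j$ in $J$). Let $\tau_0, \tau_1, \ldots, \tau_t \in \{0,1\}^{2^k}$ be such that (1) $\tau_i$ and $\tau_{i-1}$ differ in exactly one coordinate for all $i \in \{1,\dots,t\}$; (2) $\mathrm{mem}(\tau_i)$ and $\mathrm{mem}(\tau_{i-1})$ differ in exactly one coordinate for all $i \in \{1,\dots,t\}$; and (3) $\mathrm{mem}(\tau_t) = \mathrm{mem}(\tau_0)$. Then $\tau_t = \tau_0$. -}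

module Defs where

open import Data.Nat using (ℕ; zero; suc; _^_; _/_; _%_)
open import Data.Nat.Properties using (m^n≢0)
open import Data.Bool using (Bool; true; false; _∧_; _xor_)
open import Data.Fin using (Fin; toℕ)
open import Data.Vec using (Vec; lookup; tabulate; foldr; allFin)
open import Data.Product using (Σ; _×_)
open import Relation.Binary.PropositionalEquality using (_≡_; _≢_)

binBit : ℕ → ℕ → Bool
binBit J j with (J / (2 ^ j)) {{m^n≢0 2 j}} % 2
... | 0 = false
... | _ = true

⨁ : ∀ {n} → Vec Bool n → Bool
⨁ = foldr _ _xor_ false

mem : (k : ℕ) → Vec Bool (2 ^ k) → Vec Bool k
mem k τ = tabulate λ (j : Fin k) →
  ⨁ (tabulate λ (J : Fin (2 ^ k)) → binBit (toℕ J) (toℕ j) ∧ lookup τ J)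

DifferInExactlyOne : ∀ {n} → Vec Bool n → Vec Bool n → Set
DifferInExactlyOne {n} a b =
  Σ (Fin n) λ i → (lookup a i ≢ lookup b i) × (∀ j → lookup a j ≢ lookup b j → j ≡ i)

-- The map τ ↦ mem(τ) is linear over GF(2) and sends the unit vector e_J to bin(J).
-- So if τ changes in the single coordinate J while mem(τ) changes in the single
-- coordinate j, then bin(J) = e_j, i.e. J = 2^j. Hence every step of the walk
-- flips τ_{2^j} together with mem(τ)_j, and the quantity
--   Φ(τ)_J = τ_J ⊕ (mem(τ)_j if J = 2^j, and 0 otherwise)
-- is preserved along the walk. Since mem(τ_t) = mem(τ_0), Φ(τ_t) = Φ(τ_0) gives τ_t = τ_0.
module Submission where

open import Defs
open import Data.Nat using (ℕ; zero; suc; _^_; _≤_; _<_; _/_; _%_; _+_; _*_; z≤n; s≤s)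
open import Data.Nat.Properties using (m^n≢0; *-comm; ≤-refl; <⇒≤)
open import Data.Nat.DivMod using (m≡m%n+[m/n]*n; m%n<n; n/1≡n; m<n*o⇒m/o<n; m/n/o≡m/[n*o])
open import Data.Bool using (Bool; true; false; _∧_; _xor_)
open import Data.Bool.Properties
  using (∧-identityʳ; ∧-zeroʳ; ∧-distribˡ-xor; xor-same; xor-identityʳ; xor-∧-commutativeRing)
  renaming (_≟_ to _≟ᵇ_)
open import Data.Fin using (Fin; toℕ; fromℕ<; _≟_) renaming (zero to fzero; suc to fsuc)
open import Data.Fin.Properties using (all?; toℕ<n; toℕ-injective; toℕ-fromℕ<)
open import Data.Vec using (Vec; lookup; tabulate)
open import Data.Vec.Properties using (lookup∘tabulate; tabulate-cong; tabulate∘lookup)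
open import Data.Product using (_,_; proj₁)
open import Data.Empty using (⊥-elim)
open import Function.Base using (_⟨_⟩_)
open import Relation.Nullary using (yes; no; does)
open import Relation.Nullary.Decidable using (dec-true; dec-false)
open import Relation.Binary.PropositionalEquality
open import Algebra.Bundles using (CommutativeRing)
open import Algebra.Properties.CommutativeSemigroup
  (CommutativeRing.+-commutativeSemigroup xor-∧-commutativeRing) using (interchange)

open ≡-Reasoning

xor≡false⇒≡ : ∀ {x y} → x xor y ≡ false → x ≡ y
xor≡false⇒≡ {false} {false} _ = refl
xor≡false⇒≡ {true}  {true}  _ = refl

≢⇒xor≡true : ∀ {x y} → x ≢ y → x xor y ≡ true
≢⇒xor≡true {false} {false} x≢y = ⊥-elim (x≢y refl)
≢⇒xor≡true {false} {true}  _   = refl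
≢⇒xor≡true {true}  {false} _   = refl
≢⇒xor≡true {true}  {true}  x≢y = ⊥-elim (x≢y refl)

xor-cancelʳ : ∀ z {x y} → x xor z ≡ y xor z → x ≡ y
xor-cancelʳ z {x} {y} eq = xor≡false⇒≡ (begin
  x xor y                   ≡⟨ xor-identityʳ (x xor y) ⟨
  (x xor y) xor false       ≡⟨ cong ((x xor y) xor_) (xor-same z) ⟨
  (x xor y) xor (z xor z)   ≡⟨ interchange x z y z ⟨
  (x xor z) xor (y xor z)   ≡⟨ cong (_xor (y xor z)) eq ⟩
  (y xor z) xor (y xor z)   ≡⟨ xor-same (y xor z) ⟩
  false                     ∎)

dot : ∀ {n} → (Fin n → Bool) → (Fin n → Bool) → Bool
dot c x = ⨁ (tabulate λ i → c i ∧ x i)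

dot-congʳ : ∀ {n} (c : Fin n → Bool) {x y : Fin n → Bool} → (∀ i → x i ≡ y i) → dot c x ≡ dot c y
dot-congʳ c x≗y = cong ⨁ (tabulate-cong λ i → cong (c i ∧_) (x≗y i))

dot-xorʳ : ∀ {n} (c x y : Fin n → Bool) → dot c x xor dot c y ≡ dot c (λ i → x i xor y i)
dot-xorʳ {zero}  c x y = refl
dot-xorʳ {suc n} c x y = begin
  (c fzero ∧ x fzero xor dot c′ x′) xor (c fzero ∧ y fzero xor dot c′ y′)
    ≡⟨ interchange (c fzero ∧ x fzero) (dot c′ x′) (c fzero ∧ y fzero) (dot c′ y′) ⟩
  (c fzero ∧ x fzero xor c fzero ∧ y fzero) xor (dot c′ x′ xor dot c′ y′)
    ≡⟨ cong₂ _xor_ (sym (∧-distribˡ-xor (c fzero) (x fzero) (y fzero))) (dot-xorʳ c′ x′ y′) ⟩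
  c fzero ∧ (x fzero xor y fzero) xor dot c′ (λ i → x′ i xor y′ i)
    ∎
  where
  c′ x′ y′ : Fin n → Bool
  c′ i = c (fsuc i)
  x′ i = x (fsuc i)
  y′ i = y (fsuc i)

dot-zeroʳ : ∀ {n} (c : Fin n → Bool) → dot c (λ _ → false) ≡ false
dot-zeroʳ {zero}  c = refl
dot-zeroʳ {suc n} c = cong₂ _xor_ (∧-zeroʳ (c fzero)) (dot-zeroʳ (λ i → c (fsuc i)))

dot-indicatorʳ : ∀ {n} (c : Fin n → Bool) (i : Fin n) → dot c (λ j → does (j ≟ i)) ≡ c i
dot-indicatorʳ {suc n} c fzero =
  cong₂ _xor_ (∧-identityʳ (c fzero)) (dot-zeroʳ (λ j → c (fsuc j)))
  ⟨ trans ⟩ xor-identityʳ (c fzero)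
dot-indicatorʳ {suc n} c (fsuc i) =
  cong (c fzero ∧ false xor_) (dot-indicatorʳ (λ j → c (fsuc j)) i)
  ⟨ trans ⟩ cong (_xor c (fsuc i)) (∧-zeroʳ (c fzero))

diff : ∀ {n} → Vec Bool n → Vec Bool n → Fin n → Bool
diff a b i = lookup a i xor lookup b i

diff-indicator : ∀ {n} (a b : Vec Bool n) (D : DifferInExactlyOne a b) →
                 ∀ j → diff a b j ≡ does (j ≟ proj₁ D)
diff-indicator a b (i , aᵢ≢bᵢ , unique) j with j ≟ i
... | yes refl = ≢⇒xor≡true aᵢ≢bᵢ
... | no j≢i with lookup a j ≟ᵇ lookup b j
...   | yes aⱼ≡bⱼ = cong (_xor lookup b j) aⱼ≡bⱼ ⟨ trans ⟩ xor-same (lookup b j)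
...   | no aⱼ≢bⱼ  = ⊥-elim (j≢i (unique j aⱼ≢bⱼ))

nonzero : ℕ → Bool
nonzero zero    = false
nonzero (suc _) = true

binBit≡nonzero : ∀ J j → binBit J j ≡ nonzero ((J / 2 ^ j) {{m^n≢0 2 j}} % 2)
binBit≡nonzero J j with (J / 2 ^ j) {{m^n≢0 2 j}} % 2
... | zero  = refl
... | suc _ = refl

binBit-zero : ∀ J → binBit J 0 ≡ nonzero (J % 2)
binBit-zero J = binBit≡nonzero J 0 ⟨ trans ⟩ cong (λ m → nonzero (m % 2)) (n/1≡n J)

binBit-suc : ∀ J j → binBit J (suc j) ≡ binBit (J / 2) j
binBit-suc J j = begin
  binBit J (suc j)
    ≡⟨ binBit≡nonzero J (suc j) ⟩
  nonzero ((J / 2 ^ suc j) {{m^n≢0 2 (suc j)}} % 2)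
    ≡⟨ cong (λ m → nonzero (m % 2)) (m/n/o≡m/[n*o] J 2 (2 ^ j) {{_}} {{m^n≢0 2 j}} {{m^n≢0 2 (suc j)}}) ⟨
  nonzero ((J / 2 / 2 ^ j) {{m^n≢0 2 j}} % 2)
    ≡⟨ binBit≡nonzero (J / 2) j ⟨
  binBit (J / 2) j
    ∎

nonzero-injective-mod2 : ∀ m n → nonzero (m % 2) ≡ nonzero (n % 2) → m % 2 ≡ n % 2
nonzero-injective-mod2 m n eq with m % 2 | n % 2 | m%n<n m 2 | m%n<n n 2
... | 0 | 0 | _ | _ = refl
... | 1 | 1 | _ | _ = refl
... | 0 | 1 | _ | _ with () ← eq
... | 1 | 0 | _ | _ with () ← eq
... | suc (suc _) | _ | s≤s (s≤s ()) | _
... | _ | suc (suc _) | _ | s≤s (s≤s ())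

<2^suc⇒/2<2^ : ∀ {m} k → m < 2 ^ suc k → m / 2 < 2 ^ k
<2^suc⇒/2<2^ {m} k m< = m<n*o⇒m/o<n {m} {2 ^ k} {2} (subst (m <_) (*-comm 2 (2 ^ k)) m<)

binBits-injective : ∀ k {m n} → m < 2 ^ k → n < 2 ^ k →
                    (∀ j → j < k → binBit m j ≡ binBit n j) → m ≡ n
binBits-injective zero {zero}  {zero}  _       _       _    = refl
binBits-injective zero {suc _} {_}     (s≤s ()) _      _
binBits-injective zero {zero}  {suc _} _       (s≤s ()) _
binBits-injective (suc k) {m} {n} m< n< same = begin
  m                    ≡⟨ m≡m%n+[m/n]*n m 2 ⟩
  m % 2 + m / 2 * 2    ≡⟨ cong₂ (λ r q → r + q * 2) same-parity same-half ⟩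
  n % 2 + n / 2 * 2    ≡⟨ m≡m%n+[m/n]*n n 2 ⟨
  n                    ∎
  where
  same-parity : m % 2 ≡ n % 2
  same-parity = nonzero-injective-mod2 m n
    (sym (binBit-zero m) ⟨ trans ⟩ same 0 (s≤s z≤n) ⟨ trans ⟩ binBit-zero n)
  same-half : m / 2 ≡ n / 2
  same-half = binBits-injective k (<2^suc⇒/2<2^ k m<) (<2^suc⇒/2<2^ k n<)
    λ j j<k → sym (binBit-suc m j) ⟨ trans ⟩ same (suc j) (s≤s j<k) ⟨ trans ⟩ binBit-suc n j

bin : ∀ {k} → Fin (2 ^ k) → Fin k → Bool
bin J j = binBit (toℕ J) (toℕ j)

bin-injective : ∀ {k} {J J′ : Fin (2 ^ k)} → (∀ j → bin J j ≡ bin J′ j) → J ≡ J′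
bin-injective {k} {J} {J′} same = toℕ-injective (binBits-injective k (toℕ<n J) (toℕ<n J′)
  λ j j<k → subst (λ i → binBit (toℕ J) i ≡ binBit (toℕ J′) i) (toℕ-fromℕ< j<k) (same (fromℕ< j<k)))

mem-diff : ∀ k (a b : Vec Bool (2 ^ k)) (j : Fin k) →
           diff (mem k a) (mem k b) j ≡ dot (λ J → bin J j) (diff a b)
mem-diff k a b j =
  cong₂ _xor_ (lookup∘tabulate (memBit a) j) (lookup∘tabulate (memBit b) j)
  ⟨ trans ⟩ dot-xorʳ (λ J → bin J j) (lookup a) (lookup b)
  where
  memBit : Vec Bool (2 ^ k) → Fin k → Bool
  memBit τ j′ = dot (λ J → bin J j′) (lookup τ)

mem-diff-single : ∀ k (a b : Vec Bool (2 ^ k)) (D : DifferInExactlyOne a b) →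
                  ∀ j → diff (mem k a) (mem k b) j ≡ bin (proj₁ D) j
mem-diff-single k a b D j =
  mem-diff k a b j
  ⟨ trans ⟩ dot-congʳ (λ J → bin J j) (diff-indicator a b D)
  ⟨ trans ⟩ dot-indicatorʳ (λ J → bin J j) (proj₁ D)

flipped-index-is-unit : ∀ k (a b : Vec Bool (2 ^ k))
  (D : DifferInExactlyOne a b) (Dₘ : DifferInExactlyOne (mem k a) (mem k b)) →
  ∀ j → bin (proj₁ D) j ≡ does (j ≟ proj₁ Dₘ)
flipped-index-is-unit k a b D Dₘ j =
  sym (mem-diff-single k a b D j) ⟨ trans ⟩ diff-indicator (mem k a) (mem k b) Dₘ j

isUnitAt : ∀ {k} → Fin (2 ^ k) → Fin k → Bool
isUnitAt J j = does (all? λ j′ → bin J j′ ≟ᵇ does (j′ ≟ j))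

isUnitAt-unique : ∀ {k} {J₀ : Fin (2 ^ k)} {j₀ : Fin k} →
                  (∀ j → bin J₀ j ≡ does (j ≟ j₀)) → ∀ J → isUnitAt J j₀ ≡ does (J ≟ J₀)
isUnitAt-unique {J₀ = J₀} unit J with J ≟ J₀
... | yes refl = dec-true (all? _) unit
... | no J≢J₀  = dec-false (all? _) λ unitJ → J≢J₀ (bin-injective λ j → unitJ j ⟨ trans ⟩ sym (unit j))

invariant : ∀ k → Vec Bool (2 ^ k) → Fin (2 ^ k) → Bool
invariant k τ J = lookup τ J xor dot (isUnitAt J) (lookup (mem k τ))

invariant-step : ∀ k (a b : Vec Bool (2 ^ k)) →
                 DifferInExactlyOne a b → DifferInExactlyOne (mem k a) (mem k b) →
                 ∀ J → invariant k a J ≡ invariant k b J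
invariant-step k a b D Dₘ J = xor≡false⇒≡ (begin
  (lookup a J xor memPart a) xor (lookup b J xor memPart b)
    ≡⟨ interchange (lookup a J) (memPart a) (lookup b J) (memPart b) ⟩
  diff a b J xor (memPart a xor memPart b)
    ≡⟨ cong (diff a b J xor_) memPart-diff ⟩
  diff a b J xor does (J ≟ proj₁ D)
    ≡⟨ cong (_xor does (J ≟ proj₁ D)) (diff-indicator a b D J) ⟩
  does (J ≟ proj₁ D) xor does (J ≟ proj₁ D)
    ≡⟨ xor-same (does (J ≟ proj₁ D)) ⟩
  false
    ∎)
  where
  memPart : Vec Bool (2 ^ k) → Bool
  memPart τ = dot (isUnitAt J) (lookup (mem k τ))
  memPart-diff : memPart a xor memPart b ≡ does (J ≟ proj₁ D)
  memPart-diff =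
    dot-xorʳ (isUnitAt J) (lookup (mem k a)) (lookup (mem k b))
    ⟨ trans ⟩ dot-congʳ (isUnitAt J) (diff-indicator (mem k a) (mem k b) Dₘ)
    ⟨ trans ⟩ dot-indicatorʳ (isUnitAt J) (proj₁ Dₘ)
    ⟨ trans ⟩ isUnitAt-unique (flipped-index-is-unit k a b D Dₘ) J

lookup-extensionality : ∀ {A : Set} {n} {a b : Vec A n} → (∀ i → lookup a i ≡ lookup b i) → a ≡ b
lookup-extensionality {a = a} {b} same =
  sym (tabulate∘lookup a) ⟨ trans ⟩ tabulate-cong same ⟨ trans ⟩ tabulate∘lookup b

claim3p6 : (k : ℕ) → 1 ≤ k → (t : ℕ) → (τ : ℕ → Vec Bool (2 ^ k))
    → (∀ i → i < t → DifferInExactlyOne (τ (suc i)) (τ i))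
    → (∀ i → i < t → DifferInExactlyOne (mem k (τ (suc i))) (mem k (τ i)))
    → mem k (τ t) ≡ mem k (τ 0)
    → τ t ≡ τ 0
claim3p6 k _ t τ steps memSteps mem-closed = lookup-extensionality λ J →
  xor-cancelʳ (dot (isUnitAt J) (lookup (mem k (τ 0))))
    (cong (λ m → lookup (τ t) J xor dot (isUnitAt J) (lookup m)) (sym mem-closed)
     ⟨ trans ⟩ invariant-along t ≤-refl J)
  where
  invariant-along : ∀ i → i ≤ t → ∀ J → invariant k (τ i) J ≡ invariant k (τ 0) J
  invariant-along zero    _   J = refl
  invariant-along (suc i) i<t J =
    invariant-step k (τ (suc i)) (τ i) (steps i i<t) (memSteps i i<t) J
    ⟨ trans ⟩ invariant-along i (<⇒≤ i<t) J
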